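{- Let $G$ be a cycle-star graph on $n$ vertices whose unique cycle has length $c\geq4$. Then there is a cycle-star graph $G'$ on $n$ vertices whose unique cycle has length $3$ such that $H_{A}(G)<H_{A}(G')$.
   Context: All graphs are finite and simple. For a graph $G$, $\delta_G(v)$ is the degree of $v$ and $d_G(u,v)$ the distance between $u$ and $v$. The additively weighted Harary index is $H_A(G)=\sum_{\{u,v\}}\frac{\delta_G(u)+\delta_G(v)}{d_G(u,v)}$, over unordered pairs of distinct vertices. A unicyclic graph is a connected graph with exactly one cycle. A cycle-star graph is a unicyclic graph consisting only of its cycle and leaves (degree-one vertices) attached to vertices of the cycle, i.e. every vertex not on the cycle is a leaf adjacent to a cycle vertex (the cycle itself counts as a cycle-star graph). -}

module Defs where

open import Data.Nat using (ℕ; zero; suc; _<_; _≤_; _∸_; _<ᵇ_)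
open import Data.Fin using (Fin; toℕ; _≟_)
open import Data.Bool using (Bool; true; false; _∨_; _∧_; not; if_then_else_)
open import Data.List using (List; []; _∷_; length; filter; filterᵇ; foldr; concatMap; map; allFin; upTo; takeWhileᵇ)
open import Data.Bool.ListAction using (any)
open import Data.Integer using (+_)
open import Data.Rational using (ℚ; 0ℚ; _/_; _+_)
open import Data.Product using (Σ; ∃; ∃-syntax; _×_; _,_)
open import Data.Sum using (_⊎_)
open import Relation.Nullary using (¬_)
open import Relation.Nullary.Decidable using (⌊_⌋)
open import Relation.Binary.PropositionalEquality using (_≡_; _≢_)

record Graph (n : ℕ) : Set where
  field
    adj    : Fin n → Fin n → Bool
    sym    : ∀ u v → adj u v ≡ adj v u
    irrefl : ∀ v → adj v v ≡ false
open Graph public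

module _ {n : ℕ} (G : Graph n) where

  deg : Fin n → ℕ
  deg v = length (filterᵇ (adj G v) (allFin n))

  walk≤ : ℕ → Fin n → Fin n → Bool
  walk≤ zero    u v = ⌊ u ≟ v ⌋
  walk≤ (suc k) u v = walk≤ k u v ∨ any (λ w → walk≤ k u w ∧ adj G w v) (allFin n)

  Connected : Set
  Connected = ∀ u v → ∃[ k ] (walk≤ k u v ≡ true)

  -- distance d_G(u,v): the least k < n such that a walk of length ≤ k exists
  -- (= length of a shortest u–v path). For disconnected pairs this returns n,
  -- which never matters here since all graphs considered are connected.
  dist : Fin n → Fin n → ℕ
  dist u v = length (takeWhileᵇ (λ k → not (walk≤ k u v)) (upTo n))

  term : Fin n → Fin n → ℚ
  term u v with dist u v
  ... | zero  = 0ℚ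
  ... | suc d = (+ (deg u Data.Nat.+ deg v)) / suc d

  H-A : ℚ
  H-A = foldr _+_ 0ℚ
          (concatMap (λ u → map (term u) (filterᵇ (λ v → toℕ u <ᵇ toℕ v) (allFin n)))
                     (allFin n))

  Consec : (c : ℕ) → Fin c → Fin c → Set
  Consec c i j = (toℕ j ≡ suc (toℕ i)) ⊎ ((toℕ i ≡ c ∸ 1) × (toℕ j ≡ 0))

  record Cycle (c : ℕ) : Set where
    field
      len≥3  : 3 ≤ c
      vtx    : Fin c → Fin n
      inj    : ∀ i j → vtx i ≡ vtx j → i ≡ j
      closed : ∀ i j → Consec c i j → adj G (vtx i) (vtx j) ≡ true
  open Cycle public

  EdgeOf : ∀ {c} → Cycle c → Fin n → Fin n → Set
  EdgeOf {c} C a b = ∃[ i ] ∃[ j ] (Consec c i j ×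
      (((vtx C i ≡ a) × (vtx C j ≡ b)) ⊎ ((vtx C i ≡ b) × (vtx C j ≡ a))))

  -- two cycles are the same subgraph iff they have the same edge set
  SameCycle : ∀ {c c'} → Cycle c → Cycle c' → Set
  SameCycle C C' = ∀ a b → (EdgeOf C a b → EdgeOf C' a b) × (EdgeOf C' a b → EdgeOf C a b)

  OnCycle : ∀ {c} → Cycle c → Fin n → Set
  OnCycle C v = ∃[ i ] (vtx C i ≡ v)

  UnicyclicWith : ∀ {c} → Cycle c → Set
  UnicyclicWith C = Connected × (∀ c' (C' : Cycle c') → SameCycle C' C)

  IsCycleStar : ℕ → Set
  IsCycleStar c = Σ (Cycle c) λ C → UnicyclicWith C ×
    (∀ v → ¬ OnCycle C v → (deg v ≡ 1) × (∃[ w ] (OnCycle C w × (adj G v w ≡ true))))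

-- For distinct u and v the summand (δ u + δ v) / d(u,v) of H_A is at most (δ u + δ v) / 2, and at most
-- δ u + δ v when u and v are adjacent; so 2 H_A(G) ≤ Σ_{u<v} (1 + [uv ∈ E]) (δ u + δ v) = (n − 1) M₀ + M₁,
-- where M₀ = Σ δ and M₁ = Σ δ² (the first Zagreb index), with equality when G has diameter at most 2.
-- The triangle with the other n − 3 vertices pendant at one corner is a cycle-star graph of diameter 2 with
-- M₀ = 2n and M₁ = (n − 1)² + n + 5. In a cycle-star graph G whose cycle has length c ≥ 4 there are
-- ℓ ≤ n − 4 pendant vertices, and since the cycle is the only one it has no chords: each cycle vertex has
-- degree 2 + eₓ with Σ eₓ ≤ ℓ. Hence M₀(G) ≤ 2n and M₁(G) ≤ 4n + ℓ(ℓ + 1) < (n − 1)² + n + 5.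

module Submission where

open import Data.Bool using (Bool; true; false; T?; not; _∨_; _∧_; if_then_else_)
open import Data.Bool.ListAction using (any)
open import Data.Bool.Properties using (T-≡; ∨-zeroʳ; ∨-comm)
open import Data.Empty using (⊥-elim)
open import Data.Fin using (Fin; zero; suc; toℕ; fromℕ; fromℕ<; inject₁; punchOut; _↑ˡ_)
open import Data.Fin.Properties as Finₚ using (_≟_)
open import Data.Integer as ℤ using (ℤ)
import Data.Integer.Properties as ℤₚ
open import Data.Integer.Tactic.RingSolver renaming (solve-∀ to ℤ-solve-∀)
open import Data.List
  using (List; []; _∷_; _++_; length; foldr; map; filterᵇ; tabulate; concatMap; takeWhileᵇ; applyUpTo; allFin)
open import Data.List.Membership.Propositional using (lose)
open import Data.List.Membership.Propositional.Properties using (∈-allFin)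
open import Data.List.Relation.Unary.Any.Properties using (any⁺)
open import Data.Nat as ℕ using (ℕ; zero; suc; pred; _∸_; >-nonZero; _+_; _*_; _≤_; _<_; _<ᵇ_; z≤n; s≤s)
open import Data.Nat.Properties hiding (_≟_)
open import Data.Nat.Tactic.RingSolver using (solve-∀)
open import Data.Product using (∃-syntax; Σ-syntax; _×_; _,_; proj₁)
open import Data.Rational as ℚ using (ℚ; 0ℚ; _/_; toℚᵘ)
import Data.Rational.Properties as ℚₚ
import Data.Rational.Unnormalised as ℚᵘ
import Data.Rational.Unnormalised.Properties as ℚᵘₚ
open import Data.Sum as Sum using (_⊎_; inj₁; inj₂)
open import Function using (_∘_; id)
open import Function.Bundles using (Equivalence)
open import Function.Definitions using (Injective)
open import Relation.Binary.Definitions using (tri<; tri≈; tri>)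
open import Relation.Binary.PropositionalEquality
open import Relation.Nullary using (¬_; Dec; yes; no; contradiction)
open import Relation.Nullary.Decidable using (⌊_⌋; does; isYes≗does; dec-true; dec-false)
open import Algebra.Properties.Semiring.Sum +-*-semiring
  using (sum; sum-syntax; sum-cong-≗; ∑-distrib-+; ∑-comm; *-distribˡ-sum; *-distribʳ-sum; sum-replicate-zero)

open import Defs renaming (sym to adj-sym)

does-true⇒ : ∀ {A : Set} (a? : Dec A) → does a? ≡ true → A
does-true⇒ (yes a) _ = a

does-false⇒ : ∀ {A : Set} (a? : Dec A) → does a? ≡ false → ¬ A
does-false⇒ (no ¬a) _ = ¬a

𝟙 : Bool → ℕ
𝟙 b = if b then 1 else 0

δ : ∀ {n} → Fin n → Fin n → ℕ
δ x a = 𝟙 (does (x ≟ a))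

δ-refl : ∀ {n} (x : Fin n) → δ x x ≡ 1
δ-refl x = cong 𝟙 (dec-true (x ≟ x) refl)

𝟙+𝟙not : ∀ b → 𝟙 b + 𝟙 (not b) ≡ 1
𝟙+𝟙not true  = refl
𝟙+𝟙not false = refl

𝟙*≤ : ∀ b k → 𝟙 b * k ≤ k
𝟙*≤ true  k = ≤-reflexive (*-identityˡ k)
𝟙*≤ false k = z≤n

𝟙*-split : ∀ b d → (b ≡ true → 2 ≤ d) → 𝟙 b * d ≡ 𝟙 b * 2 + 𝟙 b * (d ∸ 2)
𝟙*-split true  d 2≤d =
  trans (*-identityˡ d) (sym (trans (cong₂ _+_ (*-identityˡ 2) (*-identityˡ (d ∸ 2))) (m+[n∸m]≡n (2≤d refl))))
𝟙*-split false d _   = refl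

𝟙*-complement : ∀ b d → (b ≡ false → d ≡ 1) → d ≡ 𝟙 b * d + 𝟙 (not b)
𝟙*-complement true  d _   = sym (trans (+-identityʳ _) (*-identityˡ d))
𝟙*-complement false d d≡1 = d≡1 refl

𝟙*-square-split : ∀ b d → (b ≡ true → 2 ≤ d) → (b ≡ false → d ≡ 1) →
  d * d ≡ 𝟙 b * 4 + 𝟙 b * (d ∸ 2) * 4 + 𝟙 b * (d ∸ 2) * (𝟙 b * (d ∸ 2)) + 𝟙 (not b)
𝟙*-square-split true  d 2≤d _ = trans (cong (λ t → t * t) (sym (m+[n∸m]≡n (2≤d refl)))) (expand (d ∸ 2))
  where expand : ∀ e → (2 + e) * (2 + e) ≡ 1 * 4 + 1 * e * 4 + 1 * e * (1 * e) + 0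
        expand = solve-∀
𝟙*-square-split false d _ d≡1 rewrite d≡1 refl = refl

sum-mono-≤ : ∀ {n} {f g : Fin n → ℕ} → (∀ i → f i ≤ g i) → sum f ≤ sum g
sum-mono-≤ {zero}  f≤g = z≤n
sum-mono-≤ {suc n} f≤g = +-mono-≤ (f≤g zero) (sum-mono-≤ (f≤g ∘ suc))

sum-const : ∀ n k → sum {n} (λ _ → k) ≡ n * k
sum-const zero    k = refl
sum-const (suc n) k = cong (k +_) (sum-const n k)

sum-select : ∀ {n} (a : Fin n) (h : Fin n → ℕ) → ∑[ x < n ] (δ x a * h x) ≡ h a
sum-select {suc n} zero    h = trans (cong₂ _+_ (+-identityʳ (h zero)) (sum-replicate-zero n)) (+-identityʳ _)
sum-select {suc n} (suc a) h = sum-select a (h ∘ suc)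

sum-δ : ∀ {n} (a : Fin n) → ∑[ x < n ] δ x a ≡ 1
sum-δ {n} a = trans (sum-cong-≗ {n} (λ x → sym (*-identityʳ _))) (sum-select a (λ _ → 1))

sum-δ-pair : ∀ {n} (p q : Fin n) → sum (λ y → δ y p + δ y q) ≡ 2
sum-δ-pair p q = trans (∑-distrib-+ (λ y → δ y p) (λ y → δ y q)) (cong₂ _+_ (sum-δ p) (sum-δ q))

sum-≥2 : ∀ {n} (f : Fin n → ℕ) {p q} → p ≢ q → 1 ≤ f p → 1 ≤ f q → 2 ≤ sum f
sum-≥2 f {p} {q} p≢q 1≤fp 1≤fq = subst (_≤ sum f) (sum-δ-pair p q) (sum-mono-≤ δ≤f)
  where
  δ≤f : ∀ y → δ y p + δ y q ≤ f y
  δ≤f y with y ≟ p | y ≟ q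
  ... | yes refl | yes refl = ⊥-elim (p≢q refl)
  ... | yes refl | no _     = 1≤fp
  ... | no _     | yes refl = 1≤fq
  ... | no _     | no _     = z≤n

sum-≤2 : ∀ {n} (f : Fin n → ℕ) p q → (∀ y → f y ≤ δ y p + δ y q) → sum f ≤ 2
sum-≤2 f p q f≤δ = subst (sum f ≤_) (sum-δ-pair p q) (sum-mono-≤ f≤δ)

sum-δ-injective : ∀ {m n} (h : Fin m → Fin n) → Injective _≡_ _≡_ h → ∀ x → sum (λ i → δ x (h i)) ≤ 1
sum-δ-injective {zero}  h h-inj x = z≤n
sum-δ-injective {suc m} h h-inj x with x ≟ h zero
... | yes refl = s≤s (≤-reflexive (trans (sum-cong-≗ {m} δ≡0) (sum-replicate-zero m)))
  where
  δ≡0 : ∀ i → δ (h zero) (h (suc i)) ≡ 0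
  δ≡0 i with h zero ≟ h (suc i)
  ... | yes eq = contradiction (h-inj eq) λ ()
  ... | no _   = refl
... | no _     = sum-δ-injective (h ∘ suc) (Finₚ.suc-injective ∘ h-inj) x

sum-square-≤ : ∀ {n} (f : Fin n → ℕ) → sum (λ x → f x * f x) ≤ sum f * sum f
sum-square-≤ {zero}  f = z≤n
sum-square-≤ {suc n} f = ≤-trans (+-monoʳ-≤ (a * a) (sum-square-≤ (f ∘ suc))) (square-split a s)
  where
  a = f zero
  s = sum (f ∘ suc)
  square-split : ∀ a s → a * a + s * s ≤ (a + s) * (a + s)
  square-split a s = subst (a * a + s * s ≤_) (expand a s) (m≤m+n (a * a + s * s) (2 * a * s))
    where expand : ∀ a s → a * a + s * s + 2 * a * s ≡ (a + s) * (a + s)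
          expand = solve-∀

length-filterᵇ-tabulate : ∀ {A : Set} {n} (p : A → Bool) (h : Fin n → A) →
  length (filterᵇ p (tabulate h)) ≡ sum (λ x → 𝟙 (p (h x)))
length-filterᵇ-tabulate {n = zero}  p h = refl
length-filterᵇ-tabulate {n = suc n} p h with p (h zero)
... | true  = cong suc (length-filterᵇ-tabulate p (h ∘ suc))
... | false = length-filterᵇ-tabulate p (h ∘ suc)

_<ᵇᶠ_ : ∀ {n} → Fin n → Fin n → Bool
u <ᵇᶠ v = toℕ u <ᵇ toℕ v

<ᵇᶠ⇒≢ : ∀ {n} {u v : Fin n} → u <ᵇᶠ v ≡ true → u ≢ v
<ᵇᶠ⇒≢ {u = u} u<v refl = <-irrefl refl (<ᵇ⇒< (toℕ u) (toℕ u) (Equivalence.from T-≡ u<v))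

<ᵇᶠ-true : ∀ {n} {u v : Fin n} → toℕ u < toℕ v → u <ᵇᶠ v ≡ true
<ᵇᶠ-true u<v = Equivalence.to T-≡ (<⇒<ᵇ u<v)

<ᵇᶠ-false : ∀ {n} {u v : Fin n} → ¬ toℕ u < toℕ v → u <ᵇᶠ v ≡ false
<ᵇᶠ-false {u = u} {v} u≮v = dec-false (T? (u <ᵇᶠ v)) (u≮v ∘ <ᵇ⇒< (toℕ u) (toℕ v))

split-by-order : ∀ {n} (u v : Fin n) x →
  x ≡ (if u <ᵇᶠ v then x else 0) + (if v <ᵇᶠ u then x else 0) + δ v u * x
split-by-order u v x with <-cmp (toℕ u) (toℕ v)
... | tri< u<v _ v≮u
  rewrite <ᵇᶠ-true u<v | <ᵇᶠ-false v≮u | dec-false (v ≟ u) (≢-sym (<ᵇᶠ⇒≢ (<ᵇᶠ-true u<v))) =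
  sym (trans (+-identityʳ _) (+-identityʳ x))
... | tri≈ u≮v u≡v v≮u
  rewrite <ᵇᶠ-false u≮v | <ᵇᶠ-false v≮u | Finₚ.toℕ-injective u≡v | dec-true (v ≟ v) refl =
  sym (+-identityʳ x)
... | tri> u≮v _ v<u
  rewrite <ᵇᶠ-false u≮v | <ᵇᶠ-true v<u | dec-false (v ≟ u) (<ᵇᶠ⇒≢ (<ᵇᶠ-true v<u)) =
  sym (+-identityʳ x)

pairSum : ∀ {n} → (Fin n → Fin n → ℕ) → ℕ
pairSum {n} w = ∑[ u < n ] ∑[ v < n ] (if u <ᵇᶠ v then w u v else 0)

sum-symmetric : ∀ {n} (w : Fin n → Fin n → ℕ) → (∀ u v → w u v ≡ w v u) →
  ∑[ u < n ] ∑[ v < n ] w u v ≡ pairSum w + pairSum w + ∑[ u < n ] w u u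
sum-symmetric {n} w w-sym = begin
  ∑[ u < n ] ∑[ v < n ] w u v
    ≡⟨ sum-cong-≗ {n} (λ u → sum-cong-≗ {n} (λ v → trans (split-by-order u v (w u v))
         (cong (λ t → above u v + (if v <ᵇᶠ u then t else 0) + δ v u * w u v) (w-sym u v)))) ⟩
  ∑[ u < n ] ∑[ v < n ] (above u v + above v u + δ v u * w u v)
    ≡⟨ sum-cong-≗ {n} (λ u → trans (∑-distrib-+ {n} _ _) (cong₂ _+_ (∑-distrib-+ {n} _ _) (sum-select u (w u)))) ⟩
  ∑[ u < n ] (∑[ v < n ] above u v + ∑[ v < n ] above v u + w u u)
    ≡⟨ trans (∑-distrib-+ {n} _ _) (cong (_+ ∑[ u < n ] w u u) (∑-distrib-+ {n} _ _)) ⟩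
  pairSum w + ∑[ u < n ] ∑[ v < n ] above v u + ∑[ u < n ] w u u
    ≡⟨ cong (λ t → pairSum w + t + ∑[ u < n ] w u u) (∑-comm (λ u v → above v u)) ⟩
  pairSum w + pairSum w + ∑[ u < n ] w u u ∎
  where
  open ≡-Reasoning
  above : Fin n → Fin n → ℕ
  above u v = if u <ᵇᶠ v then w u v else 0

double-injective : ∀ {x y} → x + x ≡ y + y → x ≡ y
double-injective {x} {y} x+x≡y+y =
  *-cancelˡ-≡ x y 2 (trans (cong (x +_) (+-identityʳ x)) (trans x+x≡y+y (cong (y +_) (sym (+-identityʳ y)))))

injective⇒surjective : ∀ {n} {f : Fin n → Fin n} → Injective _≡_ _≡_ f → ∀ y → ∃[ x ] f x ≡ y
injective⇒surjective {suc n} {f} f-inj y with Finₚ.any? (λ x → f x ≟ y)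
... | yes hit = hit
... | no miss = contradiction (Finₚ.injective⇒≤ squeeze-inj) 1+n≰n
  where
  y≢f : ∀ x → y ≢ f x
  y≢f x y≡fx = miss (x , sym y≡fx)
  squeeze : Fin (suc n) → Fin n
  squeeze x = punchOut (y≢f x)
  squeeze-inj : Injective _≡_ _≡_ squeeze
  squeeze-inj {x} {x′} eq = f-inj (Finₚ.punchOut-injective (y≢f x) (y≢f x′) eq)

-- Halves of natural numbers as rationals

half : ℕ → ℚ
half k = ℤ.+ k / 2

toℚᵘ-/ : ∀ a b → toℚᵘ (ℤ.+ a / suc b) ℚᵘ.≃ ℚᵘ.mkℚᵘ (ℤ.+ a) b
toℚᵘ-/ a b = ℚₚ.toℚᵘ-fromℚᵘ (ℚᵘ.mkℚᵘ (ℤ.+ a) b)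

/-mono-≤ : ∀ a b c d → a * suc d ≤ c * suc b → ℤ.+ a / suc b ℚ.≤ ℤ.+ c / suc d
/-mono-≤ a b c d ad≤cb = ℚₚ.toℚᵘ-cancel-≤
  (ℚᵘₚ.≤-respˡ-≃ (ℚᵘₚ.≃-sym (toℚᵘ-/ a b)) (ℚᵘₚ.≤-respʳ-≃ (ℚᵘₚ.≃-sym (toℚᵘ-/ c d))
    (ℚᵘ.*≤* (subst₂ ℤ._≤_ (ℤₚ.pos-* a (suc d)) (ℤₚ.pos-* c (suc b)) (ℤ.+≤+ ad≤cb)))))

/-mono-< : ∀ a b c d → a * suc d < c * suc b → ℤ.+ a / suc b ℚ.< ℤ.+ c / suc d
/-mono-< a b c d ad<cb = ℚₚ.toℚᵘ-cancel-<
  (ℚᵘₚ.<-respˡ-≃ (ℚᵘₚ.≃-sym (toℚᵘ-/ a b)) (ℚᵘₚ.<-respʳ-≃ (ℚᵘₚ.≃-sym (toℚᵘ-/ c d))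
    (ℚᵘ.*<* (subst₂ ℤ._<_ (ℤₚ.pos-* a (suc d)) (ℤₚ.pos-* c (suc b)) (ℤ.+<+ ad<cb)))))

half-< : ∀ {a b} → a < b → half a ℚ.< half b
half-< {a} {b} a<b = /-mono-< a 1 b 1 (*-monoˡ-< 2 a<b)

half-+ : ∀ a b → half a ℚ.+ half b ≡ half (a + b)
half-+ a b = ℚₚ.toℚᵘ-injective (begin
  toℚᵘ (half a ℚ.+ half b)                  ≈⟨ ℚₚ.toℚᵘ-homo-+ (half a) (half b) ⟩
  toℚᵘ (half a) ℚᵘ.+ toℚᵘ (half b)          ≈⟨ ℚᵘₚ.+-cong (toℚᵘ-/ a 1) (toℚᵘ-/ b 1) ⟩
  ℚᵘ.mkℚᵘ (ℤ.+ a) 1 ℚᵘ.+ ℚᵘ.mkℚᵘ (ℤ.+ b) 1  ≈⟨ ℚᵘ.*≡* (trans (cross (ℤ.+ a) (ℤ.+ b)) (cong (ℤ._* ℤ.+ 4) (sym (ℤₚ.pos-+ a b)))) ⟩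
  ℚᵘ.mkℚᵘ (ℤ.+ (a + b)) 1                   ≈⟨ ℚᵘₚ.≃-sym (toℚᵘ-/ (a + b) 1) ⟩
  toℚᵘ (half (a + b))                       ∎)
  where
  open ℚᵘₚ.≃-Reasoning
  cross : ∀ (x y : ℤ) → (x ℤ.* ℤ.+ 2 ℤ.+ y ℤ.* ℤ.+ 2) ℤ.* ℤ.+ 2 ≡ (x ℤ.+ y) ℤ.* ℤ.+ 4
  cross = ℤ-solve-∀

sumℚ : List ℚ → ℚ
sumℚ = foldr ℚ._+_ 0ℚ

sumℚ-++ : ∀ xs ys → sumℚ (xs ++ ys) ≡ sumℚ xs ℚ.+ sumℚ ys
sumℚ-++ []       ys = sym (ℚₚ.+-identityˡ _)
sumℚ-++ (x ∷ xs) ys = trans (cong (x ℚ.+_) (sumℚ-++ xs ys)) (sym (ℚₚ.+-assoc x _ _))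

module HalfSumBound (_∼_ : ℚ → ℚ → Set) (0∼0 : 0ℚ ∼ 0ℚ)
  (∼-+ : ∀ {p q r s} → p ∼ q → r ∼ s → (p ℚ.+ r) ∼ (q ℚ.+ s)) where

  ∼-half-+ : ∀ {p q} a b → p ∼ half a → q ∼ half b → (p ℚ.+ q) ∼ half (a + b)
  ∼-half-+ a b p∼ q∼ = subst (_ ∼_) (half-+ a b) (∼-+ p∼ q∼)

  sumℚ-filter-∼ : ∀ {A : Set} {n} (p : A → Bool) (h : Fin n → A) (F : A → ℚ) (g : A → ℕ) →
    (∀ x → p (h x) ≡ true → F (h x) ∼ half (g (h x))) →
    sumℚ (map F (filterᵇ p (tabulate h))) ∼ half (sum (λ x → if p (h x) then g (h x) else 0))
  sumℚ-filter-∼ {n = zero}  p h F g bound = 0∼0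
  sumℚ-filter-∼ {n = suc n} p h F g bound with p (h zero) in p₀
  ... | true  = ∼-half-+ (g (h zero)) _ (bound zero p₀) (sumℚ-filter-∼ p (h ∘ suc) F g (bound ∘ suc))
  ... | false = sumℚ-filter-∼ p (h ∘ suc) F g (bound ∘ suc)

  sumℚ-concatMap-∼ : ∀ {A : Set} {n} (h : Fin n → A) (Fs : A → List ℚ) (g : A → ℕ) →
    (∀ x → sumℚ (Fs (h x)) ∼ half (g (h x))) →
    sumℚ (concatMap Fs (tabulate h)) ∼ half (sum (g ∘ h))
  sumℚ-concatMap-∼ {n = zero}  h Fs g bound = 0∼0
  sumℚ-concatMap-∼ {n = suc n} h Fs g bound =
    subst (_∼ _) (sym (sumℚ-++ (Fs (h zero)) _))
      (∼-half-+ (g (h zero)) _ (bound zero) (sumℚ-concatMap-∼ (h ∘ suc) Fs g (bound ∘ suc)))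

-- Walks and distances

length-takeWhileᵇ-≤ : ∀ (p : ℕ → Bool) m (f : ℕ → ℕ) k → p (f k) ≡ false →
  length (takeWhileᵇ p (applyUpTo f m)) ≤ k
length-takeWhileᵇ-≤ p zero    f k       pfk = z≤n
length-takeWhileᵇ-≤ p (suc m) f k       pfk with p (f 0) in pf₀
length-takeWhileᵇ-≤ p (suc m) f zero    pfk | true  = contradiction (trans (sym pf₀) pfk) λ ()
length-takeWhileᵇ-≤ p (suc m) f (suc k) pfk | true  = s≤s (length-takeWhileᵇ-≤ p m (f ∘ suc) k pfk)
... | false = z≤n

length-takeWhileᵇ-≥ : ∀ (p : ℕ → Bool) m (f : ℕ → ℕ) k → k ≤ m → (∀ i → i < k → p (f i) ≡ true) →
  k ≤ length (takeWhileᵇ p (applyUpTo f m))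
length-takeWhileᵇ-≥ p m       f zero    k≤m pf = z≤n
length-takeWhileᵇ-≥ p (suc m) f (suc k) (s≤s k≤m) pf rewrite pf 0 (s≤s z≤n) =
  s≤s (length-takeWhileᵇ-≥ p m (f ∘ suc) k k≤m (λ i i<k → pf (suc i) (s≤s i<k)))

any-false : ∀ {A : Set} (f : A → Bool) xs → (∀ x → f x ≡ false) → any f xs ≡ false
any-false f []       f≡false = refl
any-false f (x ∷ xs) f≡false rewrite f≡false x = any-false f xs f≡false

⌊≟⌋-refl : ∀ {n} (u : Fin n) → ⌊ u ≟ u ⌋ ≡ true
⌊≟⌋-refl u = trans (isYes≗does (u ≟ u)) (dec-true (u ≟ u) refl)

⌊≟⌋-≢ : ∀ {n} {u v : Fin n} → u ≢ v → ⌊ u ≟ v ⌋ ≡ false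
⌊≟⌋-≢ {u = u} {v} u≢v = trans (isYes≗does (u ≟ v)) (dec-false (u ≟ v) u≢v)

≢⇒2≤ : ∀ {n} {u v : Fin n} → u ≢ v → 2 ≤ n
≢⇒2≤ {suc zero}    {zero} {zero} u≢v = ⊥-elim (u≢v refl)
≢⇒2≤ {suc (suc n)}                _   = s≤s (s≤s z≤n)

module _ {n} (G : Graph n) where

  walk≤-suc : ∀ k {u v} → walk≤ G k u v ≡ true → walk≤ G (suc k) u v ≡ true
  walk≤-suc k w rewrite w = refl

  walk≤-refl : ∀ k u → walk≤ G k u u ≡ true
  walk≤-refl zero    u = ⌊≟⌋-refl u
  walk≤-refl (suc k) u = walk≤-suc k (walk≤-refl k u)

  walk≤-step : ∀ k {u w v} → walk≤ G k u w ≡ true → adj G w v ≡ true → walk≤ G (suc k) u v ≡ true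
  walk≤-step k {u} {w} {v} uw wv =
    trans (cong (walk≤ G k u v ∨_) (Equivalence.to T-≡ (any⁺ _ (lose (∈-allFin w) via-w)))) (∨-zeroʳ _)
    where via-w = Equivalence.from T-≡ (cong₂ _∧_ uw wv)

  walk≤-one-adj : ∀ {u v} → adj G u v ≡ true → walk≤ G 1 u v ≡ true
  walk≤-one-adj {u} = walk≤-step 0 (walk≤-refl 0 u)

  walk≤-one-nonadj : ∀ {u v} → u ≢ v → adj G u v ≡ false → walk≤ G 1 u v ≡ false
  walk≤-one-nonadj {u} {v} u≢v ¬uv rewrite ⌊≟⌋-≢ u≢v = any-false _ (allFin n) no-middle
    where
    no-middle : ∀ w → (⌊ u ≟ w ⌋ ∧ adj G w v) ≡ false
    no-middle w with u ≟ w
    ... | yes refl = ¬uv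
    ... | no _     = refl

  dist-≤ : ∀ k {u v} → walk≤ G k u v ≡ true → dist G u v ≤ k
  dist-≤ k {u} {v} w = length-takeWhileᵇ-≤ (λ i → not (walk≤ G i u v)) n id k (cong not w)

  dist-≥ : ∀ k {u v} → k ≤ n → (∀ i → i < k → walk≤ G i u v ≡ false) → k ≤ dist G u v
  dist-≥ k {u} {v} k≤n no-walk =
    length-takeWhileᵇ-≥ (λ i → not (walk≤ G i u v)) n id k k≤n (λ i i<k → cong not (no-walk i i<k))

  dist-≥1 : ∀ {u v} → u ≢ v → 1 ≤ dist G u v
  dist-≥1 u≢v = dist-≥ 1 (≤-trans (s≤s z≤n) (≢⇒2≤ u≢v)) λ { zero _ → ⌊≟⌋-≢ u≢v ; (suc _) (s≤s ()) }

  dist-≥2 : ∀ {u v} → u ≢ v → adj G u v ≡ false → 2 ≤ dist G u v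
  dist-≥2 u≢v ¬uv = dist-≥ 2 (≢⇒2≤ u≢v) λ
    { zero _ → ⌊≟⌋-≢ u≢v ; (suc zero) _ → walk≤-one-nonadj u≢v ¬uv ; (suc (suc _)) (s≤s (s≤s ())) }

  term-≡ : ∀ {u v e} → dist G u v ≡ suc e → term G u v ≡ ℤ.+ (deg G u + deg G v) / suc e
  term-≡ d≡ rewrite d≡ = refl

  dist-suc : ∀ {u v} → u ≢ v → dist G u v ≡ suc (pred (dist G u v))
  dist-suc u≢v = sym (suc-pred _ {{>-nonZero (dist-≥1 u≢v)}})

-- The Harary index against degree sums

weight-≤ : ∀ s e b → (b ≡ false → 1 ≤ e) → s * 2 ≤ (1 + 𝟙 b) * s * suc e
weight-≤ s e       true  _    = subst (_≤ 2 * s * suc e) (*-comm 2 s) (m≤m*n (2 * s) (suc e))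
weight-≤ s (suc e) false _    =
  subst (λ t → s * 2 ≤ t * suc (suc e)) (sym (*-identityˡ s)) (*-monoʳ-≤ s (s≤s (s≤s z≤n)))
weight-≤ s zero    false 1≤e = contradiction (1≤e refl) λ ()

weight-≥ : ∀ s e b → (b ≡ true → e ≡ 0) → e ≤ 1 → (1 + 𝟙 b) * s * suc e ≤ s * 2
weight-≥ s e true e≡0 _ rewrite e≡0 refl = ≤-reflexive (trans (*-identityʳ (2 * s)) (*-comm 2 s))
weight-≥ s e false _ e≤1 = subst (λ t → t * suc e ≤ s * 2) (sym (*-identityˡ s)) (*-monoʳ-≤ s (s≤s e≤1))

module _ {n} (G : Graph n) where

  adjacency : Fin n → Fin n → ℕ
  adjacency u v = 𝟙 (adj G u v)

  adjacency-sym : ∀ u v → adjacency u v ≡ adjacency v u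
  adjacency-sym u v = cong 𝟙 (adj-sym G u v)

  deg≡sum : ∀ u → deg G u ≡ sum (adjacency u)
  deg≡sum u = length-filterᵇ-tabulate (adj G u) id

  degreeSum zagreb₁ : ℕ
  degreeSum = sum (deg G)
  zagreb₁   = sum (λ u → deg G u * deg G u)

  pairWeight : Fin n → Fin n → ℕ
  pairWeight u v = (1 + adjacency u v) * (deg G u + deg G v)

  pairWeightSum : ℕ
  pairWeightSum = pairSum pairWeight

  term-≤-half : ∀ {u v} → u ≢ v → term G u v ℚ.≤ half (pairWeight u v)
  term-≤-half {u} {v} u≢v = subst (ℚ._≤ half (pairWeight u v)) (sym (term-≡ G d≡))
    (/-mono-≤ s e (pairWeight u v) 1 (weight-≤ s e (adj G u v)
      (λ ¬uv → ≤-pred (subst (2 ≤_) d≡ (dist-≥2 G u≢v ¬uv)))))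
    where
    s = deg G u + deg G v
    e = pred (dist G u v)
    d≡ = dist-suc G u≢v

  term-≥-half : ∀ {u v} → u ≢ v → walk≤ G 2 u v ≡ true → half (pairWeight u v) ℚ.≤ term G u v
  term-≥-half {u} {v} u≢v w₂ = subst (half (pairWeight u v) ℚ.≤_) (sym (term-≡ G d≡))
    (/-mono-≤ (pairWeight u v) 1 s e (weight-≥ s e (adj G u v)
      (λ uv → n≤0⇒n≡0 (≤-pred (subst (_≤ 1) d≡ (dist-≤ G 1 (walk≤-one-adj G uv)))))
      (≤-pred (subst (_≤ 2) d≡ (dist-≤ G 2 w₂)))))
    where
    s = deg G u + deg G v
    e = pred (dist G u v)
    d≡ = dist-suc G u≢v

  H-A-≤ : H-A G ℚ.≤ half pairWeightSum
  H-A-≤ = sumℚ-concatMap-∼ id _ _ λ u →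
    sumℚ-filter-∼ _ id (term G u) (pairWeight u) λ v u<v → term-≤-half (<ᵇᶠ⇒≢ u<v)
    where open HalfSumBound ℚ._≤_ ℚₚ.≤-refl ℚₚ.+-mono-≤

  H-A-≥ : (∀ u v → walk≤ G 2 u v ≡ true) → half pairWeightSum ℚ.≤ H-A G
  H-A-≥ w₂ = sumℚ-concatMap-∼ id _ _ λ u →
    sumℚ-filter-∼ _ id (term G u) (pairWeight u) λ v u<v → term-≥-half (<ᵇᶠ⇒≢ u<v) (w₂ u v)
    where open HalfSumBound (λ p q → q ℚ.≤ p) ℚₚ.≤-refl ℚₚ.+-mono-≤

  sum-adjacency-* : ∀ (f : Fin n → ℕ) → ∑[ u < n ] ∑[ v < n ] (adjacency u v * f u) ≡ ∑[ u < n ] (deg G u * f u)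
  sum-adjacency-* f = sum-cong-≗ {n} λ u → trans (sym (*-distribʳ-sum (f u) (adjacency u))) (cong (_* f u) (sym (deg≡sum u)))

  sum-pairWeight : ∑[ u < n ] ∑[ v < n ] pairWeight u v ≡ (n * degreeSum + n * degreeSum) + (zagreb₁ + zagreb₁)
  sum-pairWeight = begin
    ∑[ u < n ] ∑[ v < n ] ((deg G u + deg G v) + adjacency u v * (deg G u + deg G v))
      ≡⟨ trans (sum-cong-≗ {n} (λ u → ∑-distrib-+ {n} _ _)) (∑-distrib-+ {n} _ _) ⟩
    ∑[ u < n ] ∑[ v < n ] (deg G u + deg G v) + ∑[ u < n ] ∑[ v < n ] (adjacency u v * (deg G u + deg G v))
      ≡⟨ cong₂ _+_ degree-part adjacency-part ⟩
    (n * degreeSum + n * degreeSum) + (zagreb₁ + zagreb₁) ∎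
    where
    open ≡-Reasoning
    degree-part : ∑[ u < n ] ∑[ v < n ] (deg G u + deg G v) ≡ n * degreeSum + n * degreeSum
    degree-part = begin
      ∑[ u < n ] ∑[ v < n ] (deg G u + deg G v)
        ≡⟨ sum-cong-≗ {n} (λ u → trans (∑-distrib-+ {n} _ _) (cong (_+ degreeSum) (sum-const n (deg G u)))) ⟩
      ∑[ u < n ] (n * deg G u + degreeSum)
        ≡⟨ ∑-distrib-+ {n} _ _ ⟩
      ∑[ u < n ] (n * deg G u) + ∑[ _ < n ] degreeSum
        ≡⟨ cong₂ _+_ (sym (*-distribˡ-sum n (deg G))) (sum-const n degreeSum) ⟩
      n * degreeSum + n * degreeSum ∎
    adjacency-part : ∑[ u < n ] ∑[ v < n ] (adjacency u v * (deg G u + deg G v)) ≡ zagreb₁ + zagreb₁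
    adjacency-part = begin
      ∑[ u < n ] ∑[ v < n ] (adjacency u v * (deg G u + deg G v))
        ≡⟨ trans (sum-cong-≗ {n} (λ u → trans (sum-cong-≗ {n} (λ v → *-distribˡ-+ (adjacency u v) _ _))
                                             (∑-distrib-+ {n} _ _)))
                 (∑-distrib-+ {n} _ _) ⟩
      ∑[ u < n ] ∑[ v < n ] (adjacency u v * deg G u) + ∑[ u < n ] ∑[ v < n ] (adjacency u v * deg G v)
        ≡⟨ cong (∑[ u < n ] ∑[ v < n ] (adjacency u v * deg G u) +_)
             (trans (∑-comm (λ u v → adjacency u v * deg G v))
                    (sum-cong-≗ {n} λ v → sum-cong-≗ {n} λ u → cong (_* deg G v) (adjacency-sym u v))) ⟩
      ∑[ u < n ] ∑[ v < n ] (adjacency u v * deg G u) + ∑[ v < n ] ∑[ u < n ] (adjacency v u * deg G v)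
        ≡⟨ cong₂ _+_ (sum-adjacency-* (deg G)) (sum-adjacency-* (deg G)) ⟩
      zagreb₁ + zagreb₁ ∎

  pairWeight-sym : ∀ u v → pairWeight u v ≡ pairWeight v u
  pairWeight-sym u v = cong₂ _*_ (cong suc (adjacency-sym u v)) (+-comm (deg G u) (deg G v))

  pairWeight-diagonal : ∀ u → pairWeight u u ≡ deg G u + deg G u
  pairWeight-diagonal u rewrite irrefl G u = +-identityʳ _

  pairWeightSum-identity : pairWeightSum + degreeSum ≡ n * degreeSum + zagreb₁
  pairWeightSum-identity = double-injective (begin
    (pairWeightSum + degreeSum) + (pairWeightSum + degreeSum)
      ≡⟨ +-interchange pairWeightSum degreeSum ⟩
    pairWeightSum + pairWeightSum + (degreeSum + degreeSum)
      ≡⟨ cong (pairWeightSum + pairWeightSum +_) (trans (sum-cong-≗ {n} pairWeight-diagonal) (∑-distrib-+ {n} _ _)) ⟨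
    pairWeightSum + pairWeightSum + ∑[ u < n ] pairWeight u u
      ≡⟨ sum-symmetric pairWeight pairWeight-sym ⟨
    ∑[ u < n ] ∑[ v < n ] pairWeight u v
      ≡⟨ sum-pairWeight ⟩
    (n * degreeSum + n * degreeSum) + (zagreb₁ + zagreb₁)
      ≡⟨ +-interchange (n * degreeSum) zagreb₁ ⟨
    (n * degreeSum + zagreb₁) + (n * degreeSum + zagreb₁) ∎)
    where
    open ≡-Reasoning
    +-interchange : ∀ x y → (x + y) + (x + y) ≡ (x + x) + (y + y)
    +-interchange = solve-∀

-- Cycles

-- `Consec G c` from Defs, restated without its unused graph argument.
CyclicSucc : (c : ℕ) → Fin c → Fin c → Set
CyclicSucc c i j = (toℕ j ≡ suc (toℕ i)) ⊎ ((toℕ i ≡ c ∸ 1) × (toℕ j ≡ 0))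

module _ {c : ℕ} where

  next : Fin (suc c) → Fin (suc c)
  next i with suc (toℕ i) ℕ.<? suc c
  ... | yes i+1<c = fromℕ< i+1<c
  ... | no _      = zero

  prev : Fin (suc c) → Fin (suc c)
  prev zero    = fromℕ c
  prev (suc i) = inject₁ i

  private
    last-of : ∀ {i : Fin (suc c)} → ¬ suc (toℕ i) < suc c → toℕ i ≡ c
    last-of {i} i+1≮c = ≤-antisym (Finₚ.toℕ≤pred[n] i) (≮⇒≥ (i+1≮c ∘ s≤s))

  CyclicSucc-next : ∀ i → CyclicSucc (suc c) i (next i)
  CyclicSucc-next i with suc (toℕ i) ℕ.<? suc c
  ... | yes i+1<c = inj₁ (Finₚ.toℕ-fromℕ< i+1<c)
  ... | no i+1≮c  = inj₂ (last-of i+1≮c , refl)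

  next-unique : ∀ {i j} → CyclicSucc (suc c) i j → j ≡ next i
  next-unique {i} {j} succ with suc (toℕ i) ℕ.<? suc c | succ
  ... | yes i+1<c | inj₁ j≡i+1         = Finₚ.toℕ-injective (trans j≡i+1 (sym (Finₚ.toℕ-fromℕ< i+1<c)))
  ... | yes i+1<c | inj₂ (i≡c , _)     = contradiction (subst (λ t → suc t < suc c) i≡c i+1<c) (<-irrefl refl)
  ... | no i+1≮c  | inj₁ j≡i+1         = contradiction (subst (_< suc c) j≡i+1 (Finₚ.toℕ<n j)) i+1≮c
  ... | no _      | inj₂ (_ , j≡0)     = Finₚ.toℕ-injective j≡0

  CyclicSucc-prev : ∀ i → CyclicSucc (suc c) (prev i) i
  CyclicSucc-prev zero    = inj₂ (Finₚ.toℕ-fromℕ c , refl)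
  CyclicSucc-prev (suc i) = inj₁ (cong suc (sym (Finₚ.toℕ-inject₁ i)))

  prev-unique : ∀ {i j} → CyclicSucc (suc c) j i → j ≡ prev i
  prev-unique {zero}  (inj₂ (j≡c , _)) = Finₚ.toℕ-injective (trans j≡c (sym (Finₚ.toℕ-fromℕ c)))
  prev-unique {suc i} (inj₁ i+1≡j+1)   =
    Finₚ.toℕ-injective (trans (sym (suc-injective i+1≡j+1)) (sym (Finₚ.toℕ-inject₁ i)))

CyclicSucc-both⇒≤2 : ∀ {c} {i j : Fin (suc c)} → CyclicSucc (suc c) i j → CyclicSucc (suc c) j i → suc c ≤ 2
CyclicSucc-both⇒≤2 (inj₁ j≡i+1) (inj₁ i≡j+1) =
  contradiction (<-trans (n<1+n _) (n<1+n _)) (<-irrefl (trans i≡j+1 (cong suc j≡i+1)))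
CyclicSucc-both⇒≤2 (inj₁ j≡i+1) (inj₂ (j≡c , i≡0)) =
  s≤s (≤-reflexive (trans (sym j≡c) (trans j≡i+1 (cong suc i≡0))))
CyclicSucc-both⇒≤2 (inj₂ (i≡c , j≡0)) (inj₁ i≡j+1) =
  s≤s (≤-reflexive (trans (sym i≡c) (trans i≡j+1 (cong suc j≡0))))
CyclicSucc-both⇒≤2 (inj₂ (i≡c , j≡0)) (inj₂ (j≡c , _)) =
  s≤s (≤-trans (≤-reflexive (trans (sym j≡c) j≡0)) z≤n)

next≢prev : ∀ {c} (i : Fin (3 + c)) → next i ≢ prev i
next≢prev i next≡prev
  with CyclicSucc-both⇒≤2 (CyclicSucc-next i) (subst (λ j → CyclicSucc _ j i) (sym next≡prev) (CyclicSucc-prev i))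
... | s≤s (s≤s ())

CyclicSucc⇒≢ : ∀ {c} {i j : Fin (2 + c)} → CyclicSucc (2 + c) i j → i ≢ j
CyclicSucc⇒≢ (inj₁ i≡i+1) refl = <-irrefl i≡i+1 (n<1+n _)
CyclicSucc⇒≢ (inj₂ (i≡c+1 , i≡0)) refl = contradiction (trans (sym i≡c+1) i≡0) λ ()

-- The arc i, i + 1, …, j of C, closed up by a chord from j back to i.
module _ {n c} (G : Graph n) (C : Cycle G c) {i j : Fin c} (r : ℕ) (i+2+r≡j : toℕ i + suc (suc r) ≡ toℕ j) where

  private
    arc-bound : (m : Fin (3 + r)) → toℕ i + toℕ m < c
    arc-bound m = ≤-<-trans (+-monoʳ-≤ (toℕ i) (Finₚ.toℕ≤pred[n] m)) (subst (_< c) (sym i+2+r≡j) (Finₚ.toℕ<n j))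

  arc : Fin (3 + r) → Fin c
  arc m = fromℕ< (arc-bound m)

  toℕ-arc : ∀ m → toℕ (arc m) ≡ toℕ i + toℕ m
  toℕ-arc m = Finₚ.toℕ-fromℕ< (arc-bound m)

  arc-last : arc (fromℕ (2 + r)) ≡ j
  arc-last = Finₚ.toℕ-injective (trans (toℕ-arc _) (trans (cong (toℕ i +_) (Finₚ.toℕ-fromℕ (2 + r))) i+2+r≡j))

  arc-zero : arc zero ≡ i
  arc-zero = Finₚ.toℕ-injective (trans (toℕ-arc zero) (+-identityʳ (toℕ i)))

  arc-CyclicSucc : ∀ {m m'} → toℕ m' ≡ suc (toℕ m) → CyclicSucc c (arc m) (arc m')
  arc-CyclicSucc {m} {m'} m'≡m+1 =
    inj₁ (trans (toℕ-arc m') (trans (cong (toℕ i +_) m'≡m+1)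
                                 (trans (+-suc (toℕ i) (toℕ m)) (cong suc (sym (toℕ-arc m))))))

  chordCycle : adj G (vtx C j) (vtx C i) ≡ true → Cycle G (3 + r)
  chordCycle chord = record
    { len≥3  = s≤s (s≤s (s≤s z≤n))
    ; vtx    = vtx C ∘ arc
    ; inj    = λ m m' same → Finₚ.toℕ-injective (+-cancelˡ-≡ (toℕ i) _ _
                 (trans (sym (toℕ-arc m)) (trans (cong toℕ (inj C _ _ same)) (toℕ-arc m'))))
    ; closed = closed′
    }
    where
    closed′ : ∀ m m' → CyclicSucc (3 + r) m m' → adj G (vtx C (arc m)) (vtx C (arc m')) ≡ true
    closed′ m m' (inj₁ m'≡m+1) = closed C _ _ (arc-CyclicSucc m'≡m+1)
    closed′ m m' (inj₂ (m≡last , m'≡0)) = subst₂ (λ x y → adj G (vtx C x) (vtx C y) ≡ true)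
      (sym (trans (cong arc (Finₚ.toℕ-injective (trans m≡last (sym (Finₚ.toℕ-fromℕ (2 + r)))))) arc-last))
      (sym (trans (cong arc (Finₚ.toℕ-injective m'≡0)) arc-zero))
      chord

  chordCycle-edge : (chord : adj G (vtx C j) (vtx C i) ≡ true) → EdgeOf G (chordCycle chord) (vtx C j) (vtx C i)
  chordCycle-edge chord = fromℕ (2 + r) , zero , inj₂ (Finₚ.toℕ-fromℕ (2 + r) , refl) ,
    inj₁ (cong (vtx C) arc-last , cong (vtx C) arc-zero)

module _ {n c} (G : Graph n) (C : Cycle G c) (unique : ∀ c' (C' : Cycle G c') → SameCycle G C' C) where

  EdgeOf⇒CyclicSucc : ∀ {i j} → EdgeOf G C (vtx C i) (vtx C j) → CyclicSucc c i j ⊎ CyclicSucc c j i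
  EdgeOf⇒CyclicSucc (p , q , succ , inj₁ (p↦i , q↦j)) =
    inj₁ (subst₂ (CyclicSucc c) (inj C _ _ p↦i) (inj C _ _ q↦j) succ)
  EdgeOf⇒CyclicSucc (p , q , succ , inj₂ (p↦j , q↦i)) =
    inj₂ (subst₂ (CyclicSucc c) (inj C _ _ p↦j) (inj C _ _ q↦i) succ)

  private
    adjacent-forward : ∀ {i j} → toℕ i < toℕ j → adj G (vtx C i) (vtx C j) ≡ true → CyclicSucc c i j ⊎ CyclicSucc c j i
    adjacent-forward {i} {j} i<j ij with m≤n⇒m<n∨m≡n i<j
    ... | inj₂ i+1≡j = inj₁ (inj₁ (sym i+1≡j))
    ... | inj₁ i+2≤j with r , i+2+r≡j ← m≤n⇒∃[o]m+o≡n i+2≤j =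
      Sum.swap (EdgeOf⇒CyclicSucc (proj₁ (unique _ (chordCycle G C r i+2+r≡j′ chord) (vtx C j) (vtx C i))
                                         (chordCycle-edge G C r i+2+r≡j′ chord)))
      where
      i+2+r≡j′ : toℕ i + suc (suc r) ≡ toℕ j
      i+2+r≡j′ = trans (trans (+-suc (toℕ i) (suc r)) (cong suc (+-suc (toℕ i) r))) i+2+r≡j
      chord : adj G (vtx C j) (vtx C i) ≡ true
      chord = trans (adj-sym G _ _) ij

  -- A chord would close an arc of C into a second cycle containing an edge that C lacks.
  adjacent-on-cycle : ∀ {i j} → adj G (vtx C i) (vtx C j) ≡ true → CyclicSucc c i j ⊎ CyclicSucc c j i
  adjacent-on-cycle {i} {j} ij with <-cmp (toℕ i) (toℕ j)
  ... | tri< i<j _ _ = adjacent-forward i<j ij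
  ... | tri> _ _ j<i = Sum.swap (adjacent-forward j<i (trans (adj-sym G _ _) ij))
  ... | tri≈ _ i≡j _ rewrite Finₚ.toℕ-injective i≡j = contradiction (trans (sym ij) (irrefl G _)) λ ()

CyclicSucc₃-total : ∀ {i j : Fin 3} → i ≢ j → CyclicSucc 3 i j ⊎ CyclicSucc 3 j i
CyclicSucc₃-total {zero}           {zero}           i≢j = contradiction refl i≢j
CyclicSucc₃-total {zero}           {suc zero}       _   = inj₁ (inj₁ refl)
CyclicSucc₃-total {zero}           {suc (suc zero)} _   = inj₂ (inj₂ (refl , refl))
CyclicSucc₃-total {suc zero}       {zero}           _   = inj₂ (inj₁ refl)
CyclicSucc₃-total {suc zero}       {suc zero}       i≢j = contradiction refl i≢j
CyclicSucc₃-total {suc zero}       {suc (suc zero)} _   = inj₁ (inj₁ refl)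
CyclicSucc₃-total {suc (suc zero)} {zero}           _   = inj₁ (inj₂ (refl , refl))
CyclicSucc₃-total {suc (suc zero)} {suc zero}       _   = inj₂ (inj₁ refl)
CyclicSucc₃-total {suc (suc zero)} {suc (suc zero)} i≢j = contradiction refl i≢j

-- Cycle-star graphs

module CycleStarCount {n c} (G : Graph n) (C : Cycle G (4 + c))
  (unique : ∀ c' (C' : Cycle G c') → SameCycle G C' C)
  (leaf : ∀ v → ¬ OnCycle G C v → (deg G v ≡ 1) × (∃[ w ] (OnCycle G C w × (adj G v w ≡ true)))) where

  onCycle? : ∀ x → Dec (OnCycle G C x)
  onCycle? x = Finₚ.any? (λ i → vtx C i ≟ x)

  𝟙on 𝟙off : Fin n → ℕ
  𝟙on  x = 𝟙 (does (onCycle? x))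
  𝟙off x = 𝟙 (not (does (onCycle? x)))

  cycleOrder leafCount : ℕ
  cycleOrder = sum 𝟙on
  leafCount  = sum 𝟙off

  cycleOrder+leafCount : cycleOrder + leafCount ≡ n
  cycleOrder+leafCount = trans (sym (∑-distrib-+ 𝟙on 𝟙off))
    (trans (sum-cong-≗ {n} (𝟙+𝟙not ∘ does ∘ onCycle?)) (trans (sum-const n 1) (*-identityʳ n)))

  𝟙on-yes : ∀ {x} → OnCycle G C x → 𝟙on x ≡ 1
  𝟙on-yes on = cong 𝟙 (dec-true (onCycle? _) on)

  𝟙on-no : ∀ {x} → ¬ OnCycle G C x → 𝟙on x ≡ 0
  𝟙on-no ¬on = cong 𝟙 (dec-false (onCycle? _) ¬on)

  𝟙off-yes : ∀ {x} → OnCycle G C x → 𝟙off x ≡ 0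
  𝟙off-yes on = cong (𝟙 ∘ not) (dec-true (onCycle? _) on)

  𝟙off-no : ∀ {x} → ¬ OnCycle G C x → 𝟙off x ≡ 1
  𝟙off-no ¬on = cong (𝟙 ∘ not) (dec-false (onCycle? _) ¬on)

  length≤cycleOrder : 4 + c ≤ cycleOrder
  length≤cycleOrder = begin
    4 + c                                     ≡⟨ trans (sum-const (4 + c) 1) (*-identityʳ _) ⟨
    ∑[ i < 4 + c ] 1                          ≡⟨ sum-cong-≗ {4 + c} (λ i → sum-δ (vtx C i)) ⟨
    ∑[ i < 4 + c ] ∑[ x < n ] δ x (vtx C i)   ≡⟨ ∑-comm (λ i x → δ x (vtx C i)) ⟩
    ∑[ x < n ] ∑[ i < 4 + c ] δ x (vtx C i)   ≤⟨ sum-mono-≤ hits≤𝟙on ⟩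
    cycleOrder                                ∎
    where
    open ≤-Reasoning
    hits≤𝟙on : ∀ x → ∑[ i < 4 + c ] δ x (vtx C i) ≤ 𝟙on x
    hits≤𝟙on x with onCycle? x
    ... | yes on  = subst (∑[ i < 4 + c ] δ x (vtx C i) ≤_) (sym (𝟙on-yes on)) (sum-δ-injective (vtx C) (inj C _ _) x)
    ... | no ¬on = ≤-reflexive (trans (sum-cong-≗ {4 + c} (λ i → cong 𝟙 (dec-false (x ≟ vtx C i) (¬on ∘ (i ,_) ∘ sym))))
                                     (trans (sum-replicate-zero (4 + c)) (sym (𝟙on-no ¬on))))

  deg-off : ∀ x → ¬ OnCycle G C x → deg G x ≡ 1
  deg-off x ¬on = proj₁ (leaf x ¬on)

  deg-on : ∀ i → 2 ≤ deg G (vtx C i)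
  deg-on i = subst (2 ≤_) (sym (deg≡sum G (vtx C i)))
    (sum-≥2 (adjacency G (vtx C i)) (next≢prev i ∘ inj C _ _)
      (≤-reflexive (sym (cong 𝟙 (closed C i (next i) (CyclicSucc-next i)))))
      (≤-reflexive (sym (cong 𝟙 (trans (adj-sym G _ _) (closed C (prev i) i (CyclicSucc-prev i)))))))

  cycle-neighbour : ∀ {i j} → adj G (vtx C i) (vtx C j) ≡ true → j ≡ next i ⊎ j ≡ prev i
  cycle-neighbour ij = Sum.map next-unique prev-unique (adjacent-on-cycle G C unique ij)

  cycle-neighbours-≤ : ∀ y → ∑[ x < n ] (𝟙on x * adjacency G y x) ≤ 𝟙on y * 2 + 𝟙off y
  cycle-neighbours-≤ y with onCycle? y
  ... | no ¬on = begin
    ∑[ x < n ] (𝟙on x * adjacency G y x)   ≤⟨ sum-mono-≤ (λ x → 𝟙*≤ (does (onCycle? x)) _) ⟩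
    sum (adjacency G y)                 ≡⟨ trans (sym (deg≡sum G y)) (deg-off y ¬on) ⟩
    1                                   ≡⟨ cong₂ (λ a b → a * 2 + b) (𝟙on-no ¬on) (𝟙off-no ¬on) ⟨
    𝟙on y * 2 + 𝟙off y                  ∎
    where open ≤-Reasoning
  ... | yes on@(i , refl) = begin
    ∑[ x < n ] (𝟙on x * adjacency G y x)   ≤⟨ sum-≤2 _ (vtx C (next i)) (vtx C (prev i)) next-or-prev ⟩
    2                                   ≡⟨ cong₂ (λ a b → a * 2 + b) (𝟙on-yes on) (𝟙off-yes on) ⟨
    𝟙on y * 2 + 𝟙off y                  ∎
    where
    open ≤-Reasoning
    next-or-prev : ∀ x → 𝟙on x * adjacency G (vtx C i) x ≤ δ x (vtx C (next i)) + δ x (vtx C (prev i))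
    next-or-prev x with onCycle? x
    ... | no ¬on =
      subst (λ k → k * adjacency G (vtx C i) x ≤ δ x (vtx C (next i)) + δ x (vtx C (prev i))) (sym (𝟙on-no ¬on)) z≤n
    ... | yes (j , refl) with adj G (vtx C i) (vtx C j) in ij
    ...   | false =
      subst (_≤ δ (vtx C j) (vtx C (next i)) + δ (vtx C j) (vtx C (prev i))) (sym (*-zeroʳ (𝟙on (vtx C j)))) z≤n
    ...   | true with cycle-neighbour ij
    ...     | inj₁ refl = ≤-trans (𝟙*≤ (does (onCycle? (vtx C j))) 1)
                            (subst (λ k → 1 ≤ k + δ (vtx C j) (vtx C (prev i))) (sym (δ-refl (vtx C j))) (s≤s z≤n))
    ...     | inj₂ refl = ≤-trans (𝟙*≤ (does (onCycle? (vtx C j))) 1)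
                            (subst (λ k → 1 ≤ δ (vtx C j) (vtx C (next i)) + k) (sym (δ-refl (vtx C j))) (m≤n+m 1 _))

  on-deg≥2 : ∀ x → does (onCycle? x) ≡ true → 2 ≤ deg G x
  on-deg≥2 x on with i , refl ← does-true⇒ (onCycle? x) on = deg-on i

  off-deg≡1 : ∀ x → does (onCycle? x) ≡ false → deg G x ≡ 1
  off-deg≡1 x off = deg-off x (does-false⇒ (onCycle? x) off)

  excess : Fin n → ℕ
  excess x = 𝟙on x * (deg G x ∸ 2)

  totalExcess : ℕ
  totalExcess = sum excess

  sum-on-deg≡ : ∑[ x < n ] (𝟙on x * deg G x) ≡ cycleOrder * 2 + totalExcess
  sum-on-deg≡ = trans (sum-cong-≗ {n} λ x → 𝟙*-split (does (onCycle? x)) (deg G x) (on-deg≥2 x))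
                      (trans (∑-distrib-+ {n} _ _) (cong (_+ totalExcess) (sym (*-distribʳ-sum 2 𝟙on))))

  sum-on-deg≤ : ∑[ x < n ] (𝟙on x * deg G x) ≤ cycleOrder * 2 + leafCount
  sum-on-deg≤ = begin
    ∑[ x < n ] (𝟙on x * deg G x)
      ≡⟨ sum-cong-≗ {n} (λ x → trans (cong (𝟙on x *_) (deg≡sum G x)) (*-distribˡ-sum {n} (𝟙on x) _)) ⟩
    ∑[ x < n ] ∑[ y < n ] (𝟙on x * adjacency G x y)
      ≡⟨ ∑-comm (λ x y → 𝟙on x * adjacency G x y) ⟩
    ∑[ y < n ] ∑[ x < n ] (𝟙on x * adjacency G x y)
      ≡⟨ sum-cong-≗ {n} (λ y → sum-cong-≗ {n} λ x → cong (𝟙on x *_) (adjacency-sym G x y)) ⟩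
    ∑[ y < n ] ∑[ x < n ] (𝟙on x * adjacency G y x)
      ≤⟨ sum-mono-≤ cycle-neighbours-≤ ⟩
    ∑[ y < n ] (𝟙on y * 2 + 𝟙off y)
      ≡⟨ trans (∑-distrib-+ {n} _ _) (cong (_+ leafCount) (sym (*-distribʳ-sum 2 𝟙on))) ⟩
    cycleOrder * 2 + leafCount ∎
    where open ≤-Reasoning

  totalExcess≤leafCount : totalExcess ≤ leafCount
  totalExcess≤leafCount = +-cancelˡ-≤ (cycleOrder * 2) _ _ (subst (_≤ cycleOrder * 2 + leafCount) sum-on-deg≡ sum-on-deg≤)

  degreeSum-≤ : degreeSum G ≤ 2 * n
  degreeSum-≤ = begin
    degreeSum G
      ≡⟨ sum-cong-≗ {n} (λ x → 𝟙*-complement (does (onCycle? x)) (deg G x) (off-deg≡1 x)) ⟩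
    ∑[ x < n ] (𝟙on x * deg G x + 𝟙off x)
      ≡⟨ trans (∑-distrib-+ {n} _ _) (cong (_+ leafCount) sum-on-deg≡) ⟩
    cycleOrder * 2 + totalExcess + leafCount
      ≤⟨ +-monoˡ-≤ leafCount (+-monoʳ-≤ (cycleOrder * 2) totalExcess≤leafCount) ⟩
    cycleOrder * 2 + leafCount + leafCount
      ≡⟨ regroup cycleOrder leafCount ⟩
    2 * (cycleOrder + leafCount)
      ≡⟨ cong (2 *_) cycleOrder+leafCount ⟩
    2 * n ∎
    where
    open ≤-Reasoning
    regroup : ∀ k l → k * 2 + l + l ≡ 2 * (k + l)
    regroup = solve-∀

  zagreb₁-≤ : zagreb₁ G ≤ 4 * n + leafCount * suc leafCount
  zagreb₁-≤ = begin
    zagreb₁ G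
      ≡⟨ sum-cong-≗ {n} (λ x → 𝟙*-square-split (does (onCycle? x)) (deg G x) (on-deg≥2 x) (off-deg≡1 x)) ⟩
    ∑[ x < n ] (𝟙on x * 4 + excess x * 4 + excess x * excess x + 𝟙off x)
      ≡⟨ trans (∑-distrib-+ {n} _ _) (cong (_+ leafCount) (trans (∑-distrib-+ {n} _ _)
           (cong (_+ ∑[ x < n ] (excess x * excess x))
             (trans (∑-distrib-+ {n} _ _) (sym (cong₂ _+_ (*-distribʳ-sum 4 𝟙on) (*-distribʳ-sum 4 excess))))))) ⟩
    cycleOrder * 4 + totalExcess * 4 + ∑[ x < n ] (excess x * excess x) + leafCount
      ≤⟨ +-monoˡ-≤ leafCount (+-monoʳ-≤ (cycleOrder * 4 + totalExcess * 4) (sum-square-≤ excess)) ⟩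
    cycleOrder * 4 + totalExcess * 4 + totalExcess * totalExcess + leafCount
      ≤⟨ +-monoˡ-≤ leafCount (+-mono-≤ (+-monoʳ-≤ (cycleOrder * 4) (*-monoˡ-≤ 4 totalExcess≤leafCount))
                                       (*-mono-≤ totalExcess≤leafCount totalExcess≤leafCount)) ⟩
    cycleOrder * 4 + leafCount * 4 + leafCount * leafCount + leafCount
      ≡⟨ regroup cycleOrder leafCount ⟩
    4 * (cycleOrder + leafCount) + leafCount * suc leafCount
      ≡⟨ cong (λ m → 4 * m + leafCount * suc leafCount) cycleOrder+leafCount ⟩
    4 * n + leafCount * suc leafCount ∎
    where
    open ≤-Reasoning
    regroup : ∀ k l → k * 4 + l * 4 + l * l + l ≡ 4 * (k + l) + l * suc l
    regroup = solve-∀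

  4+leafCount≤n : 4 + leafCount ≤ n
  4+leafCount≤n = subst (4 + leafCount ≤_) cycleOrder+leafCount
    (+-monoˡ-≤ leafCount (≤-trans (m≤m+n 4 c) length≤cycleOrder))

-- The triangle with pendant vertices

module TriangleWithPendants (m : ℕ) where

  arrow : Fin (4 + m) → Fin (4 + m) → Bool
  arrow zero       (suc _)          = true
  arrow (suc zero) (suc (suc zero)) = true
  arrow _          _                = false

  Δ : Graph (4 + m)
  Δ = record
    { adj    = λ u v → arrow u v ∨ arrow v u
    ; sym    = λ u v → ∨-comm (arrow u v) (arrow v u)
    ; irrefl = λ { zero → refl ; (suc zero) → refl ; (suc (suc zero)) → refl ; (suc (suc (suc _))) → refl }
    }

  deg-hub : deg Δ zero ≡ 3 + m
  deg-hub = trans (deg≡sum Δ zero) (trans (sum-const (3 + m) 1) (*-identityʳ _))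

  deg-corner₁ : deg Δ (suc zero) ≡ 2
  deg-corner₁ = trans (deg≡sum Δ (suc zero)) (cong (2 +_) (sum-replicate-zero (suc m)))

  deg-corner₂ : deg Δ (suc (suc zero)) ≡ 2
  deg-corner₂ = trans (deg≡sum Δ (suc (suc zero))) (cong (2 +_) (sum-replicate-zero (suc m)))

  deg-pendant : ∀ k → deg Δ (suc (suc (suc k))) ≡ 1
  deg-pendant k = trans (deg≡sum Δ (suc (suc (suc k)))) (cong suc (sum-replicate-zero (suc m)))

  degreeSum-Δ : degreeSum Δ ≡ 2 * (4 + m)
  degreeSum-Δ = trans (cong₂ _+_ deg-hub (cong₂ _+_ deg-corner₁ (cong₂ _+_ deg-corner₂ pendants))) (count m)
    where
    pendants : ∑[ k < suc m ] deg Δ (suc (suc (suc k))) ≡ suc m * 1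
    pendants = trans (sum-cong-≗ {suc m} deg-pendant) (sum-const (suc m) 1)
    count : ∀ m → 3 + m + (2 + (2 + suc m * 1)) ≡ 2 * (4 + m)
    count = solve-∀

  zagreb₁-Δ : zagreb₁ Δ ≡ (3 + m) * (3 + m) + (9 + m)
  zagreb₁-Δ = trans (cong₂ _+_ (cong₂ _*_ deg-hub deg-hub) (cong₂ _+_ (cong₂ _*_ deg-corner₁ deg-corner₁)
                      (cong₂ _+_ (cong₂ _*_ deg-corner₂ deg-corner₂) pendants))) (count m)
    where
    pendants : ∑[ k < suc m ] (deg Δ (suc (suc (suc k))) * deg Δ (suc (suc (suc k)))) ≡ suc m * 1
    pendants = trans (sum-cong-≗ {suc m} (λ k → cong₂ _*_ (deg-pendant k) (deg-pendant k))) (sum-const (suc m) 1)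
    count : ∀ m → (3 + m) * (3 + m) + (4 + (4 + suc m * 1)) ≡ (3 + m) * (3 + m) + (9 + m)
    count = solve-∀

  diameter≤2 : ∀ u v → walk≤ Δ 2 u v ≡ true
  diameter≤2 zero    zero    = walk≤-refl Δ 2 zero
  diameter≤2 zero    (suc v) = walk≤-suc Δ 1 {zero} {suc v} (walk≤-one-adj Δ {zero} {suc v} refl)
  diameter≤2 (suc u) zero    = walk≤-suc Δ 1 {suc u} {zero} (walk≤-one-adj Δ {suc u} {zero} (∨-zeroʳ _))
  diameter≤2 (suc u) (suc v) = walk≤-step Δ 1 {suc u} {zero} {suc v} (walk≤-one-adj Δ {suc u} {zero} (∨-zeroʳ _)) refl

  IsCorner : Fin (4 + m) → Set
  IsCorner x = toℕ x < 3

  corners-adjacent : ∀ {a b} → IsCorner a → IsCorner b → a ≢ b → adj Δ a b ≡ true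
  corners-adjacent {zero}           {zero}           _ _ a≢b = contradiction refl a≢b
  corners-adjacent {zero}           {suc _}          _ _ _   = refl
  corners-adjacent {suc _}          {zero}           _ _ _   = ∨-zeroʳ _
  corners-adjacent {suc zero}       {suc zero}       _ _ a≢b = contradiction refl a≢b
  corners-adjacent {suc zero}       {suc (suc zero)} _ _ _   = refl
  corners-adjacent {suc (suc zero)} {suc zero}       _ _ _   = refl
  corners-adjacent {suc (suc zero)} {suc (suc zero)} _ _ a≢b = contradiction refl a≢b
  corners-adjacent {suc (suc (suc _))} (s≤s (s≤s (s≤s ())))
  corners-adjacent {suc zero}       {suc (suc (suc _))} _ (s≤s (s≤s (s≤s ())))
  corners-adjacent {suc (suc zero)} {suc (suc (suc _))} _ (s≤s (s≤s (s≤s ())))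

  pendant-adj : ∀ k y → adj Δ (suc (suc (suc k))) y ≡ true → y ≡ zero
  pendant-adj k zero                _  = refl
  pendant-adj k (suc zero)          ()
  pendant-adj k (suc (suc zero))    ()
  pendant-adj k (suc (suc (suc _))) ()

  corner : Fin 3 → Fin (4 + m)
  corner i = i ↑ˡ suc m

  corner-IsCorner : ∀ i → IsCorner (corner i)
  corner-IsCorner i = subst (_< 3) (sym (Finₚ.toℕ-↑ˡ i (suc m))) (Finₚ.toℕ<n i)

  triangle : Cycle Δ 3
  triangle = record
    { len≥3  = ≤-refl
    ; vtx    = corner
    ; inj    = Finₚ.↑ˡ-injective (suc m)
    ; closed = λ i j succ →
        corners-adjacent (corner-IsCorner i) (corner-IsCorner j) (CyclicSucc⇒≢ succ ∘ Finₚ.↑ˡ-injective (suc m) i j)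
    }

  -- A pendant vertex on a cycle would have both of its (distinct) cycle neighbours equal to the hub.
  cycle⊆corners : ∀ {c} (C : Cycle Δ (3 + c)) i → IsCorner (vtx C i)
  cycle⊆corners C i with vtx C i in i↦
  ... | zero             = s≤s z≤n
  ... | suc zero         = s≤s (s≤s z≤n)
  ... | suc (suc zero)   = s≤s (s≤s (s≤s z≤n))
  ... | suc (suc (suc k)) = contradiction (inj C _ _ (trans (pendant-adj k _ to-next) (sym (pendant-adj k _ to-prev)))) (next≢prev i)
    where
    to-next : adj Δ (suc (suc (suc k))) (vtx C (next i)) ≡ true
    to-next = subst (λ x → adj Δ x (vtx C (next i)) ≡ true) i↦ (closed C i (next i) (CyclicSucc-next i))
    to-prev : adj Δ (suc (suc (suc k))) (vtx C (prev i)) ≡ true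
    to-prev = subst (λ x → adj Δ x (vtx C (prev i)) ≡ true) i↦
                (trans (adj-sym Δ (vtx C i) (vtx C (prev i))) (closed C (prev i) i (CyclicSucc-prev i)))

  module _ {c} (C : Cycle Δ (3 + c)) where

    toCorner : Fin (3 + c) → Fin 3
    toCorner i = fromℕ< (cycle⊆corners C i)

    toℕ-toCorner : ∀ i → toℕ (toCorner i) ≡ toℕ (vtx C i)
    toℕ-toCorner i = Finₚ.toℕ-fromℕ< (cycle⊆corners C i)

    toCorner-injective : Injective _≡_ _≡_ toCorner
    toCorner-injective {i} {j} eq =
      inj C i j (Finₚ.toℕ-injective (trans (sym (toℕ-toCorner i)) (trans (cong toℕ eq) (toℕ-toCorner j))))

    cycle-length : c ≡ 0
    cycle-length = n≤0⇒n≡0 (≤-pred (≤-pred (≤-pred (Finₚ.injective⇒≤ toCorner-injective))))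

    EdgeOf⇒corners : ∀ {a b} → EdgeOf Δ C a b → IsCorner a × IsCorner b × a ≢ b
    EdgeOf⇒corners (i , j , succ , inj₁ (refl , refl)) =
      cycle⊆corners C i , cycle⊆corners C j , CyclicSucc⇒≢ succ ∘ inj C i j
    EdgeOf⇒corners (i , j , succ , inj₂ (refl , refl)) =
      cycle⊆corners C j , cycle⊆corners C i , CyclicSucc⇒≢ succ ∘ inj C i j ∘ sym

  triangle-covers-corners : (C : Cycle Δ 3) → ∀ {x} → IsCorner x → ∃[ i ] vtx C i ≡ x
  triangle-covers-corners C {x} x-corner with i , eq ← injective⇒surjective (toCorner-injective C) (fromℕ< x-corner) =
    i , Finₚ.toℕ-injective (trans (sym (toℕ-toCorner C i)) (trans (cong toℕ eq) (Finₚ.toℕ-fromℕ< x-corner)))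

  corners⇒EdgeOf : (C : Cycle Δ 3) → ∀ {a b} → IsCorner a → IsCorner b → a ≢ b → EdgeOf Δ C a b
  corners⇒EdgeOf C {a} {b} a-corner b-corner a≢b
    with i , i↦a ← triangle-covers-corners C a-corner | j , j↦b ← triangle-covers-corners C b-corner
    with CyclicSucc₃-total (λ i≡j → a≢b (trans (sym i↦a) (trans (cong (vtx C) i≡j) j↦b)))
  ... | inj₁ succ = i , j , succ , inj₁ (i↦a , j↦b)
  ... | inj₂ succ = j , i , succ , inj₂ (j↦b , i↦a)

  triangle-unique : ∀ c' (C' : Cycle Δ c') → SameCycle Δ C' triangle
  triangle-unique zero                C' = contradiction (len≥3 C') λ ()
  triangle-unique (suc zero)          C' = contradiction (len≥3 C') λ { (s≤s ()) }
  triangle-unique (suc (suc zero))    C' = contradiction (len≥3 C') λ { (s≤s (s≤s ())) }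
  triangle-unique (suc (suc (suc c))) C' with refl ← cycle-length C' = λ a b →
    (λ e → let (a-corner , b-corner , a≢b) = EdgeOf⇒corners C' e in corners⇒EdgeOf triangle a-corner b-corner a≢b) ,
    (λ e → let (a-corner , b-corner , a≢b) = EdgeOf⇒corners triangle e in corners⇒EdgeOf C' a-corner b-corner a≢b)

  pendant-attached : ∀ v → ¬ OnCycle Δ triangle v →
    (deg Δ v ≡ 1) × (∃[ w ] (OnCycle Δ triangle w × (adj Δ v w ≡ true)))
  pendant-attached zero                ¬on = contradiction (zero , refl) ¬on
  pendant-attached (suc zero)          ¬on = contradiction (suc zero , refl) ¬on
  pendant-attached (suc (suc zero))    ¬on = contradiction (suc (suc zero) , refl) ¬on
  pendant-attached (suc (suc (suc k))) _   = deg-pendant k , zero , (zero , refl) , refl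

  Δ-cycleStar : IsCycleStar Δ 3
  Δ-cycleStar = triangle , ((λ u v → 2 , diameter≤2 u v) , triangle-unique) , pendant-attached

zagreb-gap : ∀ m l → l ≤ m → 4 * (4 + m) + l * suc l < (3 + m) * (3 + m) + (9 + m)
zagreb-gap m l l≤m = begin-strict
  4 * (4 + m) + l * suc l                      ≤⟨ +-monoʳ-≤ (4 * (4 + m)) (*-mono-≤ l≤m (s≤s l≤m)) ⟩
  4 * (4 + m) + m * suc m                      <⟨ m<m+n _ (s≤s z≤n) ⟩
  4 * (4 + m) + m * suc m + suc (suc (2 * m))  ≡⟨ expand m ⟩
  (3 + m) * (3 + m) + (9 + m)                  ∎
  where
  open ≤-Reasoning
  expand : ∀ m → 4 * (4 + m) + m * suc m + suc (suc (2 * m)) ≡ (3 + m) * (3 + m) + (9 + m)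
  expand = solve-∀

pairWeightSum-< : ∀ k {P D Z P′ D′ Z′} → P + D ≡ suc k * D + Z → P′ + D′ ≡ suc k * D′ + Z′ →
  D ≤ D′ → Z < Z′ → P < P′
pairWeightSum-< k {P} {D} {Z} {P′} {D′} {Z′} P-identity P′-identity D≤D′ Z<Z′ = begin-strict
  P            ≡⟨ solve-for-P P-identity ⟩
  k * D + Z    <⟨ +-mono-≤-< (*-monoʳ-≤ k D≤D′) Z<Z′ ⟩
  k * D′ + Z′  ≡⟨ solve-for-P P′-identity ⟨
  P′           ∎
  where
  open ≤-Reasoning
  solve-for-P : ∀ {P D Z} → P + D ≡ suc k * D + Z → P ≡ k * D + Z
  solve-for-P {P} {D} {Z} eq = +-cancelʳ-≡ D P (k * D + Z) (trans eq (shuffle D (k * D) Z))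
    where shuffle : ∀ d kd z → d + kd + z ≡ kd + z + d
          shuffle = solve-∀

module _ {m c} (G : Graph (4 + m)) (C : Cycle G (4 + c))
  (unique : ∀ c' (C' : Cycle G c') → SameCycle G C' C)
  (leaf : ∀ v → ¬ OnCycle G C v → (deg G v ≡ 1) × (∃[ w ] (OnCycle G C w × (adj G v w ≡ true)))) where

  open CycleStarCount G C unique leaf
  open TriangleWithPendants m

  pairWeightSum-<-Δ : pairWeightSum G < pairWeightSum Δ
  pairWeightSum-<-Δ = pairWeightSum-< (3 + m) (pairWeightSum-identity G) (pairWeightSum-identity Δ)
    (subst (degreeSum G ≤_) (sym degreeSum-Δ) degreeSum-≤)
    (subst (zagreb₁ G <_) (sym zagreb₁-Δ) (≤-<-trans zagreb₁-≤ (zagreb-gap m leafCount leafCount≤m)))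
    where
    leafCount≤m : leafCount ≤ m
    leafCount≤m = ≤-pred (≤-pred (≤-pred (≤-pred 4+leafCount≤n)))

  H-A-<-Δ : H-A G ℚ.< H-A Δ
  H-A-<-Δ = ℚₚ.≤-<-trans (H-A-≤ G) (ℚₚ.<-≤-trans (half-< pairWeightSum-<-Δ) (H-A-≥ Δ diameter≤2))

mainTheorem6 : (n c : ℕ) (G : Graph n) → 4 ≤ c → IsCycleStar G c →
    Σ[ G' ∈ Graph n ] (IsCycleStar G' 3 × H-A G ℚ.< H-A G')
mainTheorem6 n _ G (s≤s (s≤s (s≤s (s≤s _)))) (C , (_ , unique) , leaf)
  with m , refl ← m≤n⇒∃[o]m+o≡n (≤-trans (m≤m+n 4 _) (CycleStarCount.4+leafCount≤n G C unique leaf)) =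
  TriangleWithPendants.Δ m , TriangleWithPendants.Δ-cycleStar m , H-A-<-Δ G C unique leaf
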